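{- Let $G$ and $H$ be graphs with $n$ and $m$ vertices, respectively, and let $S \subseteq V(G)\times V(H)$ (the common vertex set of $G \square H$ and $G \boxtimes H$). If every vertex in $S$ is adjacent in $G \square H$ to at least two vertices of $(V(G)\times V(H)) \setminus S$, then $F(G \boxtimes H) \geq |S|$. In particular, if in addition $|S| = F(G \square H)$, then $F(G \boxtimes H) \geq \max\{mF(G), nF(H)\}$.
   Context: All graphs are simple, finite and undirected. The Cartesian product $G \square H$ has vertex set $V(G)\times V(H)$, with $(u,v)$ adjacent to $(u',v')$ iff either $u=u'$ and $vv'\in E(H)$, or $v=v'$ and $uu'\in E(G)$. The strong product $G \boxtimes H$ has vertex set $V(G)\times V(H)$, with $(u,v)$ adjacent to $(u',v')$ iff ($uu'\in E(G)$ and $vv'\in E(H)$), or ($u=u'$ and $vv'\in E(H)$), or ($v=v'$ and $uu'\in E(G)$). Zero forcing: each vertex is blue or white; starting from an initial set $S$ of blue vertices, repeatedly apply the color-change rule: if a blue vertex $u$ has exactly one white neighbor $v$, color $v$ blue. $S$ is a zero forcing set if eventually all vertices are blue, and a failed zero forcing set otherwise. $F(G)$ denotes the maximum cardinality of a failed zero forcing set of $G$. -}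

module Defs where

open import Data.Nat using (ℕ; _*_; _≤_)
open import Data.Fin using (Fin; remQuot)
open import Data.Fin.Subset using (Subset; _∈_; _∉_; ∣_∣)
open import Data.Product using (_×_; _,_; Σ; ∃; ∃-syntax)
open import Data.Bool using (Bool; true; false; _∧_; _∨_)
open import Relation.Binary.PropositionalEquality using (_≡_; refl) renaming (sym to ≡-sym)
open import Data.Empty using (⊥-elim)
open import Relation.Nullary using (¬_; does; yes; no)
open import Data.Fin using (_≟_)

record Graph (n : ℕ) : Set where
  field
    adj     : Fin n → Fin n → Bool
    sym     : ∀ u v → adj u v ≡ adj v u
    irrefl  : ∀ u → adj u u ≡ false
open Graph public

_∼[_]_ : ∀ {n} → Fin n → Graph n → Fin n → Set
u ∼[ G ] v = adj G u v ≡ true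

eqᵇ : ∀ {n} → Fin n → Fin n → Bool
eqᵇ i j = does (i ≟ j)

cartAdjP : ∀ {n m} → Graph n → Graph m → Fin n × Fin m → Fin n × Fin m → Bool
cartAdjP G H (u , v) (u' , v') =
  (eqᵇ u u' ∧ adj H v v') ∨ (eqᵇ v v' ∧ adj G u u')

strongAdjP : ∀ {n m} → Graph n → Graph m → Fin n × Fin m → Fin n × Fin m → Bool
strongAdjP G H (u , v) (u' , v') =
  (adj G u u' ∧ adj H v v') ∨ ((eqᵇ u u' ∧ adj H v v') ∨ (eqᵇ v v' ∧ adj G u u'))

eqᵇ-sym : ∀ {n} (i j : Fin n) → eqᵇ i j ≡ eqᵇ j i
eqᵇ-sym i j with i ≟ j | j ≟ i
... | yes _ | yes _ = refl
... | no _  | no _  = refl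
... | yes p | no q  = ⊥-elim (q (≡-sym p))
... | no p  | yes q = ⊥-elim (p (≡-sym q))

eqᵇ-refl : ∀ {n} (i : Fin n) → eqᵇ i i ≡ true
eqᵇ-refl i with i ≟ i
... | yes _ = refl
... | no p  = ⊥-elim (p refl)

cartAdjP-sym : ∀ {n m} (G : Graph n) (H : Graph m) x y →
               cartAdjP G H x y ≡ cartAdjP G H y x
cartAdjP-sym G H (u , v) (u' , v')
  rewrite eqᵇ-sym u u' | eqᵇ-sym v v' | sym G u u' | sym H v v' = refl

strongAdjP-sym : ∀ {n m} (G : Graph n) (H : Graph m) x y →
                 strongAdjP G H x y ≡ strongAdjP G H y x
strongAdjP-sym G H (u , v) (u' , v')
  rewrite eqᵇ-sym u u' | eqᵇ-sym v v' | sym G u u' | sym H v v' = refl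

cartAdjP-irrefl : ∀ {n m} (G : Graph n) (H : Graph m) x → cartAdjP G H x x ≡ false
cartAdjP-irrefl G H (u , v)
  rewrite eqᵇ-refl u | eqᵇ-refl v | irrefl G u | irrefl H v = refl

strongAdjP-irrefl : ∀ {n m} (G : Graph n) (H : Graph m) x → strongAdjP G H x x ≡ false
strongAdjP-irrefl G H (u , v)
  rewrite eqᵇ-refl u | eqᵇ-refl v | irrefl G u | irrefl H v = refl

-- The common vertex set V(G) × V(H) of G □ H and G ⊠ H is encoded as
-- Fin (n * m) via the bijection Data.Fin.remQuot / Data.Fin.combine.
pairOf : ∀ {n m} → Fin (n * m) → Fin n × Fin m
pairOf {n} {m} x = remQuot {n} m x

_□_ : ∀ {n m} → Graph n → Graph m → Graph (n * m)
G □ H = record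
  { adj    = λ x y → cartAdjP G H (pairOf x) (pairOf y)
  ; sym    = λ x y → cartAdjP-sym G H (pairOf x) (pairOf y)
  ; irrefl = λ x → cartAdjP-irrefl G H (pairOf x)
  }

_⊠_ : ∀ {n m} → Graph n → Graph m → Graph (n * m)
G ⊠ H = record
  { adj    = λ x y → strongAdjP G H (pairOf x) (pairOf y)
  ; sym    = λ x y → strongAdjP-sym G H (pairOf x) (pairOf y)
  ; irrefl = λ x → strongAdjP-irrefl G H (pairOf x)
  }

-- Forced G S v : v eventually becomes blue starting
-- from the blue set S, under the colour-change rule "a blue vertex u
-- with exactly one white neighbour v forces v".
data Forced {n : ℕ} (G : Graph n) (S : Subset n) : Fin n → Set where
  initial : ∀ {v} → v ∈ S → Forced G S v
  force   : ∀ {u v} → Forced G S u → u ∼[ G ] v →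
            (∀ w → w ∼[ G ] u → ¬ (w ≡ v) → Forced G S w) →
            Forced G S v

IsZeroForcingSet : ∀ {n} → Graph n → Subset n → Set
IsZeroForcingSet G S = ∀ v → Forced G S v

IsFailedZeroForcingSet : ∀ {n} → Graph n → Subset n → Set
IsFailedZeroForcingSet G S = ¬ IsZeroForcingSet G S

IsF : ∀ {n} → Graph n → ℕ → Set
IsF G k = (Σ _ λ S → IsFailedZeroForcingSet G S × ∣ S ∣ ≡ k)
        × (∀ S → IsFailedZeroForcingSet G S → ∣ S ∣ ≤ k)

-- A blue vertex can force only when it has a single white neighbour, so a set S
-- in which every vertex has two white neighbours is already closed under forcing;
-- every edge of G □ H is an edge of G ⊠ H, so the hypothesis makes S a failed
-- zero forcing set of G ⊠ H.  For the second part, failed sets of the factors lift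
-- to failed sets SG × V(H) and V(G) × SH of G □ H: projecting a forcing chain of
-- G □ H onto a factor gives a forcing chain of that factor, because a G-edge
-- (a , b) → (a' , b) sees every G-neighbour w of a as the vertex (w , b).
module Submission where

open import Defs
open import Data.Nat as ℕ using (ℕ; _*_; _+_; _≤_; _⊔_; z≤n)
open import Data.Nat.Properties using (*-comm; ⊔-lub; module ≤-Reasoning)
open import Data.Bool using (Bool; true; false; _∧_; _∨_)
open import Data.Bool.Properties using (∨-zeroʳ; ∧-conicalˡ; ∧-conicalʳ)
open import Data.Fin using (Fin; zero; _≟_; combine; quotient; remainder)
open import Data.Fin.Properties using (remQuot-combine; combine-remQuot)
open import Data.Fin.Subset using (Subset; _∈_; _∉_; ∣_∣; ⊤; Nonempty)
open import Data.Fin.Subset.Properties using (nonempty?; Empty-unique; ∣⊥∣≡0; ∣⊤∣≡n)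
open import Data.Vec using ([]; _∷_; _++_; map; lookup; _⊛*_)
open import Data.Vec.Properties using (lookup-⊛*; lookup-map; []=⇒lookup; lookup⇒[]=; map-id; map-const)
open import Data.Product using (_×_; _,_; proj₁; proj₂; ∃-syntax)
open import Data.Sum using (_⊎_; inj₁; inj₂)
open import Data.Empty using (⊥-elim)
open import Relation.Binary.PropositionalEquality
  using (_≡_; refl; cong; cong₂; trans; subst; module ≡-Reasoning) renaming (sym to ≡-sym)
open import Relation.Nullary using (¬_; yes; no)
open import Function using (_∘_)

_⊗_ : ∀ {n m} → Subset n → Subset m → Subset (n * m)
p ⊗ q = map _∧_ p ⊛* q

lookup-⊗ : ∀ {n m} (p : Subset n) (q : Subset m) (x : Fin (n * m)) →
           lookup (p ⊗ q) x ≡ lookup p (quotient {n} m x) ∧ lookup q (remainder {n} m x)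
lookup-⊗ {n} {m} p q x = begin
  lookup (p ⊗ q) x
    ≡⟨ cong (lookup (p ⊗ q)) (≡-sym (combine-remQuot {n} m x)) ⟩
  lookup (p ⊗ q) (combine (quotient {n} m x) (remainder {n} m x))
    ≡⟨ lookup-⊛* (map _∧_ p) q (quotient {n} m x) (remainder {n} m x) ⟩
  lookup (map _∧_ p) (quotient {n} m x) (lookup q (remainder {n} m x))
    ≡⟨ cong (λ (f : Bool → Bool) → f (lookup q (remainder {n} m x))) (lookup-map (quotient {n} m x) _∧_ p) ⟩
  lookup p (quotient {n} m x) ∧ lookup q (remainder {n} m x)
    ∎ where open ≡-Reasoning

∈-⊗⁻ : ∀ {n m} (p : Subset n) (q : Subset m) {x : Fin (n * m)} →
       x ∈ p ⊗ q → quotient {n} m x ∈ p × remainder {n} m x ∈ q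
∈-⊗⁻ {n} {m} p q {x} x∈p⊗q =
    lookup⇒[]= _ p (∧-conicalˡ _ _ both)
  , lookup⇒[]= _ q (∧-conicalʳ _ _ both)
  where
  both : lookup p (quotient {n} m x) ∧ lookup q (remainder {n} m x) ≡ true
  both = trans (≡-sym (lookup-⊗ p q x)) ([]=⇒lookup x∈p⊗q)

∣p++q∣≡∣p∣+∣q∣ : ∀ {n m} (p : Subset n) (q : Subset m) → ∣ p ++ q ∣ ≡ ∣ p ∣ + ∣ q ∣
∣p++q∣≡∣p∣+∣q∣ []          q = refl
∣p++q∣≡∣p∣+∣q∣ (true ∷ p)  q = cong ℕ.suc (∣p++q∣≡∣p∣+∣q∣ p q)
∣p++q∣≡∣p∣+∣q∣ (false ∷ p) q = ∣p++q∣≡∣p∣+∣q∣ p q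

∣p⊗q∣≡∣p∣*∣q∣ : ∀ {n m} (p : Subset n) (q : Subset m) → ∣ p ⊗ q ∣ ≡ ∣ p ∣ * ∣ q ∣
∣p⊗q∣≡∣p∣*∣q∣ []          q = refl
∣p⊗q∣≡∣p∣*∣q∣ (true ∷ p)  q = begin
  ∣ map (true ∧_) q ++ p ⊗ q ∣  ≡⟨ ∣p++q∣≡∣p∣+∣q∣ (map (true ∧_) q) (p ⊗ q) ⟩
  ∣ map (true ∧_) q ∣ + ∣ p ⊗ q ∣ ≡⟨ cong₂ _+_ (cong ∣_∣ (map-id q)) (∣p⊗q∣≡∣p∣*∣q∣ p q) ⟩
  ∣ q ∣ + ∣ p ∣ * ∣ q ∣ ∎ where open ≡-Reasoning
∣p⊗q∣≡∣p∣*∣q∣ {m = m} (false ∷ p) q = begin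
  ∣ map (false ∧_) q ++ p ⊗ q ∣  ≡⟨ ∣p++q∣≡∣p∣+∣q∣ (map (false ∧_) q) (p ⊗ q) ⟩
  ∣ map (false ∧_) q ∣ + ∣ p ⊗ q ∣ ≡⟨ cong₂ _+_ (trans (cong ∣_∣ (map-const q false)) (∣⊥∣≡0 m)) (∣p⊗q∣≡∣p∣*∣q∣ p q) ⟩
  ∣ p ∣ * ∣ q ∣ ∎ where open ≡-Reasoning

∣p⊗⊤∣≡m*∣p∣ : ∀ {n} m (p : Subset n) → ∣ p ⊗ ⊤ {m} ∣ ≡ m * ∣ p ∣
∣p⊗⊤∣≡m*∣p∣ m p = trans (∣p⊗q∣≡∣p∣*∣q∣ p ⊤) (trans (cong (∣ p ∣ *_) (∣⊤∣≡n m)) (*-comm ∣ p ∣ m))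

∣⊤⊗q∣≡n*∣q∣ : ∀ n {m} (q : Subset m) → ∣ ⊤ {n} ⊗ q ∣ ≡ n * ∣ q ∣
∣⊤⊗q∣≡n*∣q∣ n q = trans (∣p⊗q∣≡∣p∣*∣q∣ (⊤ {n}) q) (cong (_* ∣ q ∣) (∣⊤∣≡n n))

∼-sym : ∀ {N} (K : Graph N) {x y} → x ∼[ K ] y → y ∼[ K ] x
∼-sym K {x} {y} x∼y = trans (sym K y x) x∼y

Stalled : ∀ {N} → Graph N → Subset N → Set
Stalled K S = ∀ x → x ∈ S → ∃[ y₁ ] ∃[ y₂ ] (¬ y₁ ≡ y₂ × y₁ ∉ S × y₂ ∉ S × x ∼[ K ] y₁ × x ∼[ K ] y₂)

Stalled-⊆ : ∀ {N} {K L : Graph N} {S : Subset N} →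
            (∀ {x y} → x ∼[ K ] y → x ∼[ L ] y) → Stalled K S → Stalled L S
Stalled-⊆ K⊆L stalled x x∈S with stalled x x∈S
... | y₁ , y₂ , y₁≢y₂ , y₁∉S , y₂∉S , x∼y₁ , x∼y₂ = y₁ , y₂ , y₁≢y₂ , y₁∉S , y₂∉S , K⊆L x∼y₁ , K⊆L x∼y₂

Stalled⇒Forced⇒∈ : ∀ {N} {K : Graph N} {S : Subset N} → Stalled K S → ∀ {v} → Forced K S v → v ∈ S
Stalled⇒Forced⇒∈ stalled (initial v∈S) = v∈S
Stalled⇒Forced⇒∈ {K = K} stalled (force {u} {v} forced-u _ others)
  with stalled u (Stalled⇒Forced⇒∈ stalled forced-u)
... | y₁ , y₂ , y₁≢y₂ , y₁∉S , y₂∉S , u∼y₁ , u∼y₂ with y₁ ≟ v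
...   | yes refl = ⊥-elim (y₂∉S (Stalled⇒Forced⇒∈ stalled (others y₂ (∼-sym K u∼y₂) (y₁≢y₂ ∘ ≡-sym))))
...   | no y₁≢v  = ⊥-elim (y₁∉S (Stalled⇒Forced⇒∈ stalled (others y₁ (∼-sym K u∼y₁) y₁≢v)))

Stalled⇒failed : ∀ {N} {K : Graph N} {S : Subset N} → Stalled K S → Nonempty S →
                 IsFailedZeroForcingSet K S
Stalled⇒failed stalled (x , x∈S) forcing with stalled x x∈S
... | y₁ , _ , _ , y₁∉S , _ = y₁∉S (Stalled⇒Forced⇒∈ stalled (forcing y₁))

Stalled⇒∣S∣≤F : ∀ {N} {K : Graph N} {S : Subset N} {k} → Stalled K S → IsF K k → ∣ S ∣ ≤ k
Stalled⇒∣S∣≤F {N} {S = S} stalled (_ , maximal) with nonempty? S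
... | yes nonempty = maximal S (Stalled⇒failed stalled nonempty)
... | no empty rewrite Empty-unique empty | ∣⊥∣≡0 N = z≤n

module _ {N n} {K : Graph N} {G : Graph n} (π : Fin N → Fin n)
  (edge-projects : ∀ {u v} → u ∼[ K ] v →
     π u ≡ π v ⊎ (π u ∼[ G ] π v × (∀ w → w ∼[ G ] π u → ∃[ y ] (y ∼[ K ] u × π y ≡ w))))
  where

  Forced-project : ∀ {S : Subset N} {p : Subset n} → (∀ {x} → x ∈ S → π x ∈ p) →
                   ∀ {x} → Forced K S x → Forced G p (π x)
  Forced-project S⊆π⁻¹p (initial x∈S) = initial (S⊆π⁻¹p x∈S)
  Forced-project {p = p} S⊆π⁻¹p (force {u} {v} forced-u u∼v others) with edge-projects u∼v
  ... | inj₁ πu≡πv = subst (Forced G p) πu≡πv (Forced-project S⊆π⁻¹p forced-u)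
  ... | inj₂ (πu∼πv , lift) = force (Forced-project S⊆π⁻¹p forced-u) πu∼πv forced-neighbour
    where
    forced-neighbour : ∀ w → w ∼[ G ] π u → ¬ w ≡ π v → Forced G p w
    forced-neighbour w w∼πu w≢πv with lift w w∼πu
    ... | y , y∼u , refl =
      Forced-project S⊆π⁻¹p (others y y∼u (λ y≡v → w≢πv (cong π y≡v)))

module _ {n m} (G : Graph n) (H : Graph m) where

  cartAdjP-cases : ∀ {a a' b b'} → cartAdjP G H (a , b) (a' , b') ≡ true →
                   (a ≡ a' × b ∼[ H ] b') ⊎ (b ≡ b' × a ∼[ G ] a')
  cartAdjP-cases {a} {a'} {b} {b'} e with a ≟ a' | b ≟ b' | adj H b b'
  ... | yes a≡a' | _        | true  = inj₁ (a≡a' , refl)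
  ... | yes _    | yes b≡b' | false = inj₂ (b≡b' , e)
  ... | no _     | yes b≡b' | _     = inj₂ (b≡b' , e)

  cartAdjP-stepˡ : ∀ {a a'} b → a ∼[ G ] a' → cartAdjP G H (a , b) (a' , b) ≡ true
  cartAdjP-stepˡ b a∼a' rewrite eqᵇ-refl b | a∼a' = ∨-zeroʳ _

  cartAdjP-stepʳ : ∀ a {b b'} → b ∼[ H ] b' → cartAdjP G H (a , b) (a , b') ≡ true
  cartAdjP-stepʳ a b∼b' rewrite eqᵇ-refl a | b∼b' = refl

  □⊆⊠ : ∀ {x y} → x ∼[ G □ H ] y → x ∼[ G ⊠ H ] y
  □⊆⊠ {x} {y} x∼y = trans (cong (diagonal ∨_) x∼y) (∨-zeroʳ diagonal)
    where
    diagonal : Bool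
    diagonal = adj G (quotient {n} m x) (quotient {n} m y) ∧ adj H (remainder {n} m x) (remainder {n} m y)

  quotient-projects : ∀ {u v} → u ∼[ G □ H ] v →
    quotient {n} m u ≡ quotient {n} m v
    ⊎ (quotient {n} m u ∼[ G ] quotient {n} m v
       × (∀ w → w ∼[ G ] quotient {n} m u → ∃[ y ] (y ∼[ G □ H ] u × quotient {n} m y ≡ w)))
  quotient-projects {u} u∼v with cartAdjP-cases u∼v
  ... | inj₁ (a≡a' , _)  = inj₁ a≡a'
  ... | inj₂ (_ , a∼a') = inj₂ (a∼a' , lift)
    where
    lift : ∀ w → w ∼[ G ] quotient {n} m u → ∃[ y ] (y ∼[ G □ H ] u × quotient {n} m y ≡ w)
    lift w w∼a = combine w b
               , subst (λ p → cartAdjP G H p (pairOf u) ≡ true)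
                       (≡-sym (remQuot-combine w b)) (cartAdjP-stepˡ b w∼a)
               , cong proj₁ (remQuot-combine w b)
      where b = remainder {n} m u

  remainder-projects : ∀ {u v} → u ∼[ G □ H ] v →
    remainder {n} m u ≡ remainder {n} m v
    ⊎ (remainder {n} m u ∼[ H ] remainder {n} m v
       × (∀ w → w ∼[ H ] remainder {n} m u → ∃[ y ] (y ∼[ G □ H ] u × remainder {n} m y ≡ w)))
  remainder-projects {u} u∼v with cartAdjP-cases u∼v
  ... | inj₂ (b≡b' , _)  = inj₁ b≡b'
  ... | inj₁ (_ , b∼b') = inj₂ (b∼b' , lift)
    where
    lift : ∀ w → w ∼[ H ] remainder {n} m u → ∃[ y ] (y ∼[ G □ H ] u × remainder {n} m y ≡ w)
    lift w w∼b = combine a w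
               , subst (λ p → cartAdjP G H p (pairOf u) ≡ true)
                       (≡-sym (remQuot-combine a w)) (cartAdjP-stepʳ a w∼b)
               , cong proj₂ (remQuot-combine a w)
      where a = quotient {n} m u

  ⊗-failedˡ : ∀ {p : Subset n} (q : Subset m) → Fin m →
              IsFailedZeroForcingSet G p → IsFailedZeroForcingSet (G □ H) (p ⊗ q)
  ⊗-failedˡ {p} q b p-fails p⊗q-forces = p-fails λ a →
    subst (Forced G p) (cong proj₁ (remQuot-combine a b))
      (Forced-project (quotient {n} m) quotient-projects (proj₁ ∘ ∈-⊗⁻ p q) (p⊗q-forces (combine a b)))

  ⊗-failedʳ : ∀ (p : Subset n) {q : Subset m} → Fin n →
              IsFailedZeroForcingSet H q → IsFailedZeroForcingSet (G □ H) (p ⊗ q)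
  ⊗-failedʳ p {q} a q-fails p⊗q-forces = q-fails λ b →
    subst (Forced H q) (cong proj₂ (remQuot-combine a b))
      (Forced-project (remainder {n} m) remainder-projects (proj₂ ∘ ∈-⊗⁻ p q) (p⊗q-forces (combine a b)))

failed⇒vertex : ∀ {N} {K : Graph N} {S : Subset N} → IsFailedZeroForcingSet K S → Fin N
failed⇒vertex {ℕ.zero}  fails = ⊥-elim (fails λ ())
failed⇒vertex {ℕ.suc _} _     = zero

theorem3p8 : ∀ {n m} (G : Graph n) (H : Graph m) (S : Subset (n * m)) →
    (∀ x → x ∈ S → ∃[ y₁ ] ∃[ y₂ ] (¬ y₁ ≡ y₂ × y₁ ∉ S × y₂ ∉ S
                                     × x ∼[ G □ H ] y₁ × x ∼[ G □ H ] y₂)) →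
    (∀ k → IsF (G ⊠ H) k → ∣ S ∣ ≤ k)
    × (IsF (G □ H) ∣ S ∣ →
       ∀ fG fH k → IsF G fG → IsF H fH → IsF (G ⊠ H) k → m * fG ⊔ n * fH ≤ k)
theorem3p8 {n} {m} G H S stalled = S≤F⊠ , lifted-bounds
  where
  S≤F⊠ : ∀ k → IsF (G ⊠ H) k → ∣ S ∣ ≤ k
  S≤F⊠ k = Stalled⇒∣S∣≤F (Stalled-⊆ {K = G □ H} {L = G ⊠ H} (□⊆⊠ G H) stalled)

  lifted-bounds : IsF (G □ H) ∣ S ∣ →
    ∀ fG fH k → IsF G fG → IsF H fH → IsF (G ⊠ H) k → m * fG ⊔ n * fH ≤ k
  lifted-bounds (_ , □-maximal) _ _ k ((SG , SG-fails , refl) , _) ((SH , SH-fails , refl) , _) F⊠ =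
    ⊔-lub (begin
             m * ∣ SG ∣  ≡⟨ ∣p⊗⊤∣≡m*∣p∣ m SG ⟨
             ∣ SG ⊗ ⊤ ∣  ≤⟨ □-maximal _ (⊗-failedˡ G H ⊤ (failed⇒vertex SH-fails) SG-fails) ⟩
             ∣ S ∣       ≤⟨ S≤F⊠ k F⊠ ⟩
             k           ∎)
          (begin
             n * ∣ SH ∣  ≡⟨ ∣⊤⊗q∣≡n*∣q∣ n SH ⟨
             ∣ ⊤ {n} ⊗ SH ∣ ≤⟨ □-maximal _ (⊗-failedʳ G H (⊤ {n}) (failed⇒vertex SG-fails) SH-fails) ⟩
             ∣ S ∣       ≤⟨ S≤F⊠ k F⊠ ⟩
             k           ∎)
    where open ≤-Reasoning
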